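{- Let $\mu\in(0,1]$ and let $G$, $H$ be two $k$-uniform hypergraphs for which there exists a homomorphism $\psi$ from $G$ to $H$. If $H$ has the $\mu$-fractional property, then so does $G$. In particular, if a $k$-uniform hypergraph has the $\mu$-fractional property, then so do all of its subhypergraphs.
   Context: A homomorphism from $G$ to $H$ is a map $\psi\colon V(G)\to V(H)$ such that $\psi[e]\in E(H)$ for every $e\in E(G)$. A $k$-uniform hypergraph $H$ (with finite vertex set) has the $\mu$-fractional property if for every family $(w_i)_{i\in V(H)}$ of nonnegative real numbers there exists an independent set $Z\subseteq V(H)$ (a set containing no edge of $H$) such that $\sum_{i\in Z}w_i\ge \mu \sum_{i\in V(H)}w_i$. -}

module Defs where

open import Level using (Level; suc; _⊔_)
open import Data.Nat using (ℕ)
open import Data.Bool using (Bool; true; false; if_then_else_)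
open import Data.Fin using (Fin)
open import Data.Fin.Subset using (Subset; ∣_∣; _⊆_; ⁅_⁆; ⋃; ⊥)
open import Data.Vec using (lookup)
open import Data.List using (List; map; allFin)
open import Data.Product using (Σ; _×_)
open import Relation.Binary.PropositionalEquality using (_≡_)
open import Relation.Binary using (Rel; IsPartialOrder)
open import Relation.Nullary using (¬_)
open import Function.Definitions using (Injective)
open import Algebra.Bundles using (CommutativeSemiring)
import Algebra.Properties.Monoid.Sum as MonoidSum

-- Agda's stdlib has no real numbers, so weights and μ are taken
-- in an arbitrary (partially) ordered commutative semiring.  The reals
-- (with the usual order) are an instance, so the statement below
-- generalises the real-valued one.

record OrderedCommSemiring (c ℓ₁ ℓ₂ : Level) : Set (suc (c ⊔ ℓ₁ ⊔ ℓ₂)) where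
  field
    commutativeSemiring : CommutativeSemiring c ℓ₁
  open CommutativeSemiring commutativeSemiring public
  field
    _≤_            : Rel Carrier ℓ₂
    isPartialOrder : IsPartialOrder _≈_ _≤_
    0≤1            : 0# ≤ 1#
    +-mono-≤       : ∀ {x y u v} → x ≤ y → u ≤ v → (x + u) ≤ (y + v)
    *-mono-≤       : ∀ {x y u v} → 0# ≤ x → 0# ≤ u → x ≤ y → u ≤ v →
                     (x * u) ≤ (y * v)

  _<_ : Rel Carrier (ℓ₁ ⊔ ℓ₂)
  x < y = (x ≤ y) × ¬ (x ≈ y)

  open MonoidSum +-monoid public using (sum)

record Hypergraph (k : ℕ) : Set₁ where
  field
    n       : ℕ
    Edge    : Subset n → Set
    uniform : ∀ e → Edge e → ∣ e ∣ ≡ k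

open Hypergraph public

image : ∀ {n m} → (Fin n → Fin m) → Subset n → Subset m
image {n} ψ e = ⋃ (map (λ i → if lookup e i then ⁅ ψ i ⁆ else ⊥) (allFin n))

IsHomomorphism : ∀ {k} (G H : Hypergraph k) → (Fin (n G) → Fin (n H)) → Set
IsHomomorphism G H ψ = ∀ e → Edge G e → Edge H (image ψ e)

Independent : ∀ {k} (H : Hypergraph k) → Subset (n H) → Set
Independent H Z = ∀ e → Edge H e → ¬ (e ⊆ Z)

IsSubhypergraph : ∀ {k} (G H : Hypergraph k) → Set
IsSubhypergraph G H =
  Σ (Fin (n G) → Fin (n H)) λ ι → Injective _≡_ _≡_ ι × (∀ e → Edge G e → Edge H (image ι e))

module _ {c ℓ₁ ℓ₂} (R : OrderedCommSemiring c ℓ₁ ℓ₂) where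
  open OrderedCommSemiring R

  weightOn : ∀ {m} → (Fin m → Carrier) → Subset m → Carrier
  weightOn w Z = sum (λ i → if lookup Z i then w i else 0#)

  FractionalProperty : ∀ {k} → Carrier → Hypergraph k → Set (c ⊔ ℓ₂)
  FractionalProperty μ H =
    (w : Fin (n H) → Carrier) → (∀ i → 0# ≤ w i) →
    Σ (Subset (n H)) λ Z → Independent H Z × ((μ * sum w) ≤ weightOn w Z)

{-# OPTIONS --safe #-}
-- Pull a weighting of G forward along ψ: vertex j of H receives the total weight of its fibre
-- ψ⁻¹(j).  This preserves the total weight, and the weight of a set Z under the pushed-forward
-- weighting is the weight of its preimage ψ⁻¹(Z).  Preimages of independent sets of H are
-- independent in G, because a homomorphism maps an edge inside ψ⁻¹(Z) to an edge inside Z.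
-- An embedded subhypergraph is the special case of an injective ψ.
module Submission where

open import Defs
open import Level using (Level)
open import Data.Nat using (ℕ)
open import Data.Fin using (Fin; zero; suc; _≟_)
open import Data.Product using (Σ; ∃; _×_; _,_)
open import Data.Bool using (Bool; true; false; if_then_else_)
open import Data.Sum using (inj₁; inj₂)
open import Data.List using (List; []; _∷_; map; allFin)
open import Data.Vec using (lookup; tabulate)
open import Data.Vec.Properties using (lookup∘tabulate; []=⇒lookup; lookup⇒[]=)
open import Data.Fin.Subset using (Subset; _∈_; _⊆_; ⁅_⁆; ⋃; ⊥)
open import Data.Fin.Subset.Properties using (x∈p∪q⁻; ∉⊥; x∈⁅y⁆⇒x≡y)
open import Data.Empty using (⊥-elim)
open import Relation.Nullary using (does)
open import Relation.Binary.PropositionalEquality as ≡ using (_≡_)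
open import Relation.Binary.Structures using (IsPartialOrder)
import Algebra.Properties.Semiring.Sum as SemiringSum
import Relation.Binary.Reasoning.Setoid as SetoidReasoning

x∈image⁻ : ∀ {p q} (ψ : Fin p → Fin q) (e : Subset p) {x : Fin q} →
           x ∈ image ψ e → ∃ λ i → i ∈ e × x ≡ ψ i
x∈image⁻ {p} ψ e {x} = go (allFin p)
  where
  go : (is : List (Fin p)) → x ∈ ⋃ (map (λ i → if lookup e i then ⁅ ψ i ⁆ else ⊥) is) →
       ∃ λ i → i ∈ e × x ≡ ψ i
  go []       x∈⊥ = ⊥-elim (∉⊥ x∈⊥)
  go (i ∷ is) x∈∪ with x∈p∪q⁻ (if lookup e i then ⁅ ψ i ⁆ else ⊥) _ x∈∪
  ... | inj₂ x∈rest = go is x∈rest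
  ... | inj₁ x∈head with lookup e i in i∈e
  ...   | true  = i , lookup⇒[]= i e i∈e , x∈⁅y⁆⇒x≡y (ψ i) x∈head
  ...   | false = ⊥-elim (∉⊥ x∈head)

preimage : ∀ {p q} → (Fin p → Fin q) → Subset q → Subset p
preimage ψ Z = tabulate (λ i → lookup Z (ψ i))

lookup-preimage : ∀ {p q} (ψ : Fin p → Fin q) (Z : Subset q) i →
                  lookup (preimage ψ Z) i ≡ lookup Z (ψ i)
lookup-preimage ψ Z = lookup∘tabulate (λ i → lookup Z (ψ i))

image⊆ : ∀ {p q} (ψ : Fin p → Fin q) {e Z} → e ⊆ preimage ψ Z → image ψ e ⊆ Z
image⊆ ψ {e} {Z} e⊆ψ⁻¹Z x∈ψe with x∈image⁻ ψ e x∈ψe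
... | i , i∈e , ≡.refl =
  lookup⇒[]= (ψ i) Z (≡.trans (≡.sym (lookup-preimage ψ Z i)) ([]=⇒lookup (e⊆ψ⁻¹Z i∈e)))

preimage-independent : ∀ {k} {G H : Hypergraph k} {ψ : Fin (n G) → Fin (n H)} →
                       IsHomomorphism G H ψ → ∀ {Z} → Independent H Z →
                       Independent G (preimage ψ Z)
preimage-independent {ψ = ψ} ψ-hom Z-indep e e∈G e⊆ψ⁻¹Z =
  Z-indep (image ψ e) (ψ-hom e e∈G) (image⊆ ψ e⊆ψ⁻¹Z)

if-if-comm : ∀ {a} {A : Set a} (b c : Bool) (x z : A) →
             (if b then (if c then x else z) else z) ≡ (if c then (if b then x else z) else z)
if-if-comm true  true  x z = ≡.refl
if-if-comm true  false x z = ≡.refl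
if-if-comm false true  x z = ≡.refl
if-if-comm false false x z = ≡.refl

module _ {c ℓ₁ ℓ₂} (R : OrderedCommSemiring c ℓ₁ ℓ₂) where
  open OrderedCommSemiring R hiding (zero)
  open IsPartialOrder isPartialOrder using (≤-respˡ-≈; ≤-respʳ-≈) renaming (refl to ≤-refl)
  open SemiringSum semiring using (sum-cong-≋; sum-cong-≗; sum-replicate-zero; ∑-comm)
  open SetoidReasoning setoid

  if-sum : ∀ {p} (b : Bool) (f : Fin p → Carrier) →
           (if b then sum f else 0#) ≈ sum (λ i → if b then f i else 0#)
  if-sum     true  f = refl
  if-sum {p} false f = sym (sum-replicate-zero p)

  ∑-delta : ∀ {p} (a : Fin p) (f : Fin p → Carrier) →
            sum (λ j → if does (a ≟ j) then f j else 0#) ≈ f a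
  ∑-delta {ℕ.suc p} zero    f = trans (+-congˡ (sum-replicate-zero p)) (+-identityʳ (f zero))
  ∑-delta {ℕ.suc p} (suc a) f = trans (+-identityˡ _) (∑-delta a (λ j → f (suc j)))

  sum-nonneg : ∀ {p} (f : Fin p → Carrier) → (∀ i → 0# ≤ f i) → 0# ≤ sum f
  sum-nonneg {ℕ.zero}  f f≥0 = ≤-refl
  sum-nonneg {ℕ.suc p} f f≥0 =
    ≤-respˡ-≈ (+-identityˡ 0#) (+-mono-≤ (f≥0 zero) (sum-nonneg (λ i → f (suc i)) (λ i → f≥0 (suc i))))

  if-nonneg : ∀ (b : Bool) {x} → 0# ≤ x → 0# ≤ (if b then x else 0#)
  if-nonneg true  0≤x = 0≤x
  if-nonneg false _   = ≤-refl

  pushforward : ∀ {p q} → (Fin p → Fin q) → (Fin p → Carrier) → Fin q → Carrier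
  pushforward ψ w j = sum (λ i → if does (ψ i ≟ j) then w i else 0#)

  pushforward-nonneg : ∀ {p q} (ψ : Fin p → Fin q) {w : Fin p → Carrier} →
                       (∀ i → 0# ≤ w i) → ∀ j → 0# ≤ pushforward ψ w j
  pushforward-nonneg ψ w≥0 j = sum-nonneg _ (λ i → if-nonneg (does (ψ i ≟ j)) (w≥0 i))

  ∑-pushforward : ∀ {p q} (ψ : Fin p → Fin q) (w : Fin p → Carrier) (b : Fin q → Bool) →
                  sum (λ j → if b j then pushforward ψ w j else 0#) ≈
                  sum (λ i → if b (ψ i) then w i else 0#)
  ∑-pushforward {p} {q} ψ w b = begin
    sum (λ j → if b j then sum (λ i → δ i j (w i)) else 0#)
      ≈⟨ sum-cong-≋ (λ j → if-sum (b j) (λ i → δ i j (w i))) ⟩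
    sum (λ j → sum (λ i → if b j then δ i j (w i) else 0#))
      ≈⟨ ∑-comm (λ i j → if b j then δ i j (w i) else 0#) ⟨
    sum (λ i → sum (λ j → if b j then δ i j (w i) else 0#))
      ≡⟨ sum-cong-≗ (λ i → sum-cong-≗ (λ j → if-if-comm (b j) (does (ψ i ≟ j)) (w i) 0#)) ⟩
    sum (λ i → sum (λ j → δ i j (if b j then w i else 0#)))
      ≈⟨ sum-cong-≋ (λ i → ∑-delta (ψ i) (λ j → if b j then w i else 0#)) ⟩
    sum (λ i → if b (ψ i) then w i else 0#) ∎
    where
    δ : Fin p → Fin q → Carrier → Carrier
    δ i j x = if does (ψ i ≟ j) then x else 0#

  sum-pushforward : ∀ {p q} (ψ : Fin p → Fin q) (w : Fin p → Carrier) →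
                    sum (pushforward ψ w) ≈ sum w
  sum-pushforward ψ w = ∑-pushforward ψ w (λ _ → true)

  weightOn-pushforward : ∀ {p q} (ψ : Fin p → Fin q) (w : Fin p → Carrier) (Z : Subset q) →
                         weightOn R (pushforward ψ w) Z ≈ weightOn R w (preimage ψ Z)
  weightOn-pushforward ψ w Z = begin
    weightOn R (pushforward ψ w) Z                   ≈⟨ ∑-pushforward ψ w (lookup Z) ⟩
    sum (λ i → if lookup Z (ψ i) then w i else 0#)
      ≡⟨ sum-cong-≗ (λ i → ≡.cong (λ b → if b then w i else 0#) (lookup-preimage ψ Z i)) ⟨
    weightOn R w (preimage ψ Z)                      ∎

  fractionalProperty-pullback : ∀ {k} (μ : Carrier) (G H : Hypergraph k) →
                                Σ (Fin (n G) → Fin (n H)) (IsHomomorphism G H) →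
                                FractionalProperty R μ H → FractionalProperty R μ G
  fractionalProperty-pullback μ G H (ψ , ψ-hom) H-frac w w≥0
    with H-frac (pushforward ψ w) (pushforward-nonneg ψ w≥0)
  ... | Z , Z-indep , μ∑≤wZ =
    preimage ψ Z ,
    preimage-independent {G = G} {H} ψ-hom Z-indep ,
    ≤-respʳ-≈ (weightOn-pushforward ψ w Z) (≤-respˡ-≈ (*-congˡ (sum-pushforward ψ w)) μ∑≤wZ)

lemma3p2 : ∀ {c ℓ₁ ℓ₂ : Level} (R : OrderedCommSemiring c ℓ₁ ℓ₂) (μ : OrderedCommSemiring.Carrier R) →
    OrderedCommSemiring._<_ R (OrderedCommSemiring.0# R) μ → OrderedCommSemiring._≤_ R μ (OrderedCommSemiring.1# R) →
    ∀ {k : ℕ} →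
    ((G H : Hypergraph k) → Σ (Fin (n G) → Fin (n H)) (IsHomomorphism G H) →
      FractionalProperty R μ H → FractionalProperty R μ G)
    × ((G H : Hypergraph k) → IsSubhypergraph G H →
      FractionalProperty R μ H → FractionalProperty R μ G)
lemma3p2 R μ _ _ =
  fractionalProperty-pullback R μ ,
  λ G H (ι , _ , ι-hom) → fractionalProperty-pullback R μ G H (ι , ι-hom)
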